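{- Let $a,b$ be fixed positive coprime integers and $g$ a positive integer. For each integer $j$ with $0<j<g$, $$\mu_{j-1}(g)-\mu_0(g-j)\,\mu_{j-1}(j)=\mu_j(g).$$
   Context: Lattice paths take steps in $\{(1,0),(0,1)\}$. The points of a path are the lattice points it visits, including its startpoint and endpoint. A flaw of a path is a point of the path lying strictly above the line segment joining its startpoint to its endpoint. For positive integers $h$, $N_k(h)$ denotes the set of paths from $(0,0)$ to $(ha,hb)$ with exactly $k$ flaws. For $0\le j<h$, $\mu_j(h):=|N_{j(a+b)}(h)|$. -}

module Defs where

open import Data.Bool using (Bool; true; false)
open import Data.Nat using (ℕ; zero; suc; _+_; _*_; _<_; _≟_; _<?_)
open import Data.Product using (_×_; _,_)
open import Data.List using (List; []; _∷_; map; _++_; length; filter; foldl)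
open import Data.List.Scans.Base using (scanl)
open import Relation.Nullary.Decidable using (_×-dec_)
open import Relation.Unary using (Pred; Decidable)
open import Relation.Binary.PropositionalEquality using (_≡_)
open import Data.Product.Properties using (≡-dec)

-- A lattice path is a list of steps: false = (1,0) (east), true = (0,1) (north).
Path : Set
Path = List Bool

Point : Set
Point = ℕ × ℕ

step : Point → Bool → Point
step (x , y) false = (suc x , y)
step (x , y) true  = (x , suc y)

points : Path → List Point
points = scanl step (0 , 0)

endpoint : Path → Point
endpoint = foldl step (0 , 0)

allPaths : ℕ → List Path
allPaths zero    = [] ∷ []
allPaths (suc n) = map (false ∷_) (allPaths n) ++ map (true ∷_) (allPaths n)

module _ (a b : ℕ) where

  IsFlaw : ℕ → Pred Point _
  IsFlaw h (x , y) = x * (h * b) < y * (h * a)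

  isFlaw? : (h : ℕ) → Decidable (IsFlaw h)
  isFlaw? h (x , y) = x * (h * b) <? y * (h * a)

  flaws : ℕ → Path → ℕ
  flaws h p = length (filter (isFlaw? h) (points p))

  -- N_k(h): paths from (0,0) to (h a, h b) with exactly k flaws.
  -- Every such path has exactly h a + h b steps, so enumerating
  -- all step sequences of that length is exhaustive.
  InN : ℕ → ℕ → Pred Path _
  InN k h p = (endpoint p ≡ (h * a , h * b)) × (flaws h p ≡ k)

  inN? : (k h : ℕ) → Decidable (InN k h)
  inN? k h p = ≡-dec _≟_ _≟_ (endpoint p) (h * a , h * b) ×-dec (flaws h p ≟ k)

  N : ℕ → ℕ → List Path
  N k h = filter (inN? k h) (allPaths (h * a + h * b))

  μ : ℕ → ℕ → ℕ
  μ j h = length (N (j * (a + b)) h)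

{-# OPTIONS --safe #-}
module Submission where

-- Weight a north step by a and an east step by -b. The level y a - x b of a point (x, y) is then
-- positive exactly at the flaws, and a path of length h (a + b) ends at (h a, h b) iff its total
-- weight is 0. Since a and b are coprime, such a balanced path can be at level 0 only after a
-- multiple of a + b steps.
--
-- A Chung-Feller type bijection turns a balanced path with k flaws into a nonnegative bridge whose
-- last k steps all start strictly above level 0: split the path into the steps that start above
-- level 0 and those that start at or below it, and put the reversed second part before the first.
-- The identity then becomes a last-return decomposition: a nonnegative bridge of length g (a + b)
-- that stays above 0 from index (g - j + 1)(a + b) on either does so already from (g - j)(a + b)
-- on, or its last return to 0 is exactly there, where it splits into a nonnegative bridge of length
-- (g - j)(a + b) and a bridge of length j (a + b) that stays above 0 after its first a + b steps.

open import Defs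
open import Data.Nat using (ℕ; _+_; _*_; _∸_; _<_)
open import Data.Nat.Coprimality using (Coprime)
open import Relation.Binary.PropositionalEquality using (_≡_)

open import Level using (Level; 0ℓ)
open import Data.Bool using (Bool; true; false; if_then_else_)
open import Data.Nat using (zero; suc; _≤_; z≤n; s≤s; >-nonZero)
import Data.Nat as ℕ
open import Data.Nat.Properties
  using (+-comm; +-assoc; +-suc; +-identityʳ; +-cancelˡ-≡; +-cancelʳ-≡; *-comm; *-assoc; *-distribˡ-+;
         *-distribʳ-+; *-cancelʳ-≡; *-cancelˡ-<; *-monoʳ-<; ≤-reflexive; ≤-trans; <-≤-trans; <⇒≤; <⇒≱;
         m≤m+n; m+n∸m≡n; m∸n+n≡m; m<n⇒0<n∸m; m≤n⇒m⊓n≡m)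
open import Data.Nat.Divisibility using (_∣_; divides; ∣m+n∣m⇒∣n; ∣⇒≤)
open import Data.Nat.Coprimality using (coprime-divisor)
open import Data.Integer.Base as ℤ using (ℤ; 0ℤ)
open import Data.Integer.Properties using (_<?_; _≤?_)
import Data.Integer.Properties as ℤᵖ
open import Data.Integer.Tactic.RingSolver using (solve-∀)
open import Data.List using (List; []; _∷_; [_]; _∷ʳ_; map; _++_; length; filter; reverse; take; drop; foldl)
open import Data.List.Properties
  using (length-map; length-++; length-reverse; length-take; length-drop; filter-++; filter-none; filter-≐;
         ∷-injectiveʳ; map-∘; map-id-local; ++-assoc; ++-identityʳ; unfold-reverse; reverse-involutive;
         take++drop≡id; drop-drop; drop-all)
open import Data.List.Scans.Base using (scanl)
open import Data.List.Membership.Propositional using (_∈_)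
open import Data.List.Membership.Propositional.Properties
  using (∈-map⁺; ∈-map⁻; ∈-++⁺ˡ; ∈-++⁺ʳ; ∈-++⁻; ∈-filter⁺; ∈-filter⁻)
open import Data.List.Membership.Propositional.Properties.WithK using (unique∧set⇒bag)
open import Data.List.Relation.Binary.BagAndSetEquality using (∼bag⇒↭)
open import Data.List.Relation.Binary.Permutation.Propositional using (↭-sym)
open import Data.List.Relation.Binary.Permutation.Propositional.Properties using (↭-length; ↭-reverse; All-resp-↭)
open import Data.List.Relation.Unary.Any using (here)
open import Data.List.Relation.Unary.All as All using (All; []; _∷_)
import Data.List.Relation.Unary.All.Properties as All
import Data.List.Relation.Unary.AllPairs as AllPairs
import Data.List.Relation.Unary.AllPairs.Properties as AllPairs
open import Data.List.Relation.Unary.Unique.Propositional using (Unique)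
import Data.List.Relation.Unary.Unique.Propositional.Properties as Unique
open import Data.Product using (_×_; _,_; proj₁; proj₂; map₁; map₂; ∃-syntax)
open import Data.Sum using (inj₁; inj₂)
open import Function using (_∘_; id)
open import Function.Bundles using (_⇔_; mk⇔; Equivalence)
open import Relation.Nullary using (¬_; yes; no; does; contradiction)
open import Relation.Nullary.Decidable using (_×-dec_)
open import Relation.Unary using (Pred; Decidable)
open import Relation.Unary.Properties using (_∩?_; ∁?)
open import Relation.Binary.PropositionalEquality using (refl; sym; trans; cong; cong₂; subst; subst₂; module ≡-Reasoning)

private
  variable
    ℓ ℓ′ : Level

∈-allPaths : (p : Path) → p ∈ allPaths (length p)
∈-allPaths []          = here refl
∈-allPaths (false ∷ p) = ∈-++⁺ˡ (∈-map⁺ (false ∷_) (∈-allPaths p))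
∈-allPaths (true ∷ p)  = ∈-++⁺ʳ (map (false ∷_) (allPaths (length p))) (∈-map⁺ (true ∷_) (∈-allPaths p))

length-∈-allPaths : ∀ n {p} → p ∈ allPaths n → length p ≡ n
length-∈-allPaths zero    (here refl) = refl
length-∈-allPaths (suc n) p∈ with ∈-++⁻ (map (false ∷_) (allPaths n)) p∈
... | inj₁ p∈ˡ with _ , q∈ , refl ← ∈-map⁻ (false ∷_) p∈ˡ = cong suc (length-∈-allPaths n q∈)
... | inj₂ p∈ʳ with _ , q∈ , refl ← ∈-map⁻ (true ∷_) p∈ʳ = cong suc (length-∈-allPaths n q∈)

allPaths-unique : ∀ n → Unique (allPaths n)
allPaths-unique zero    = All.[] AllPairs.∷ AllPairs.[]
allPaths-unique (suc n) = Unique.++⁺ (Unique.map⁺ ∷-injectiveʳ (allPaths-unique n))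
                                     (Unique.map⁺ ∷-injectiveʳ (allPaths-unique n)) disjoint
  where
  disjoint : ∀ {p} → ¬ (p ∈ map (false ∷_) (allPaths n) × p ∈ map (true ∷_) (allPaths n))
  disjoint (p∈ˡ , p∈ʳ) with _ , _ , refl ← ∈-map⁻ (false ∷_) p∈ˡ | _ , _ , () ← ∈-map⁻ (true ∷_) p∈ʳ

Sized : ℕ → Pred Path ℓ → Pred Path ℓ
Sized n P p = length p ≡ n × P p

count : ℕ → {P : Pred Path ℓ} → Decidable P → ℕ
count n P? = length (filter P? (allPaths n))

module _ {n : ℕ} {P : Pred Path ℓ} (P? : Decidable P) where

  ∈-count⁺ : ∀ {p} → Sized n P p → p ∈ filter P? (allPaths n)
  ∈-count⁺ {p} (refl , Pp) = ∈-filter⁺ P? (∈-allPaths p) Pp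

  ∈-count⁻ : ∀ {p} → p ∈ filter P? (allPaths n) → Sized n P p
  ∈-count⁻ p∈ with p∈allPaths , Pp ← ∈-filter⁻ P? p∈ = length-∈-allPaths n p∈allPaths , Pp

count-bijection : ∀ {n} {P : Pred Path ℓ} {Q : Pred Path ℓ′} (P? : Decidable P) (Q? : Decidable Q)
  (f g : Path → Path) →
  (∀ {p} → Sized n P p → Sized n Q (f p)) → (∀ {q} → Sized n Q q → Sized n P (g q)) →
  (∀ {p} → Sized n P p → g (f p) ≡ p) → (∀ {q} → Sized n Q q → f (g q) ≡ q) →
  count n P? ≡ count n Q?
count-bijection {n = n} P? Q? f g f-into g-into g∘f f∘g = begin
  length Ps          ≡⟨ length-map f Ps ⟨
  length (map f Ps)  ≡⟨ ↭-length (∼bag⇒↭ (unique∧set⇒bag f[Ps]-unique Qs-unique same-elements)) ⟩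
  length Qs          ∎
  where
  open ≡-Reasoning
  Ps = filter P? (allPaths n)
  Qs = filter Q? (allPaths n)
  Qs-unique : Unique Qs
  Qs-unique = Unique.filter⁺ Q? (allPaths-unique n)
  g[f[Ps]]≡Ps : map g (map f Ps) ≡ Ps
  g[f[Ps]]≡Ps = trans (sym (map-∘ Ps)) (map-id-local (All.tabulate (g∘f ∘ ∈-count⁻ P?)))
  f[Ps]-unique : Unique (map f Ps)
  f[Ps]-unique = AllPairs.map (λ g[x]≢g[y] → g[x]≢g[y] ∘ cong g)
    (AllPairs.map⁻ (subst Unique (sym g[f[Ps]]≡Ps) (Unique.filter⁺ P? (allPaths-unique n))))
  same-elements : ∀ {q} → (q ∈ map f Ps) ⇔ (q ∈ Qs)
  same-elements = mk⇔
    (λ q∈ → let _ , p∈ , q≡ = ∈-map⁻ f q∈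
            in subst (_∈ Qs) (sym q≡) (∈-count⁺ Q? (f-into (∈-count⁻ P? p∈))))
    (λ q∈ → let Qq = ∈-count⁻ Q? q∈ in subst (_∈ map f Ps) (f∘g Qq) (∈-map⁺ f (∈-count⁺ P? (g-into Qq))))

count-cong : ∀ {n} {P : Pred Path ℓ} {Q : Pred Path ℓ′} (P? : Decidable P) (Q? : Decidable Q) →
  (∀ {p} → length p ≡ n → P p ⇔ Q p) → count n P? ≡ count n Q?
count-cong P? Q? P⇔Q = count-bijection P? Q? id id
  (λ (|p| , Pp) → |p| , Equivalence.to (P⇔Q |p|) Pp) (λ (|q| , Qq) → |q| , Equivalence.from (P⇔Q |q|) Qq)
  (λ _ → refl) (λ _ → refl)

filter-map : ∀ {A B : Set} {P : Pred B ℓ} (P? : Decidable P) (f : A → B) (xs : List A) →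
  filter P? (map f xs) ≡ map f (filter (P? ∘ f) xs)
filter-map P? f []       = refl
filter-map P? f (x ∷ xs) with P? (f x)
... | yes _ = cong (f x ∷_) (filter-map P? f xs)
... | no  _ = filter-map P? f xs

count-suc : ∀ n {P : Pred Path ℓ} (P? : Decidable P) →
  count (suc n) P? ≡ count n (P? ∘ (false ∷_)) + count n (P? ∘ (true ∷_))
count-suc n P? = begin
  length (filter P? (map (false ∷_) Ps ++ map (true ∷_) Ps))
    ≡⟨ cong length (filter-++ P? (map (false ∷_) Ps) (map (true ∷_) Ps)) ⟩
  length (filter P? (map (false ∷_) Ps) ++ filter P? (map (true ∷_) Ps))
    ≡⟨ length-++ (filter P? (map (false ∷_) Ps)) ⟩
  length (filter P? (map (false ∷_) Ps)) + length (filter P? (map (true ∷_) Ps))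
    ≡⟨ cong₂ _+_ (length-filter-map (false ∷_)) (length-filter-map (true ∷_)) ⟩
  count n (P? ∘ (false ∷_)) + count n (P? ∘ (true ∷_)) ∎
  where
  open ≡-Reasoning
  Ps = allPaths n
  length-filter-map : ∀ f → length (filter P? (map f Ps)) ≡ length (filter (P? ∘ f) Ps)
  length-filter-map f = trans (cong length (filter-map P? f Ps)) (length-map f (filter (P? ∘ f) Ps))

count-concat : ∀ m k {P : Pred Path ℓ} {Q : Pred Path ℓ′} (P? : Decidable P) (Q? : Decidable Q) →
  count (m + k) (λ p → P? (take m p) ×-dec Q? (drop m p)) ≡ count m P? * count k Q?
count-concat zero k P? Q? with P? []
... | yes P[] = trans (count-cong {n = k} _ Q? (λ _ → mk⇔ proj₂ (P[] ,_))) (sym (+-identityʳ _))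
... | no ¬P[] = cong length (filter-none _ (All.universal (λ _ → ¬P[] ∘ proj₁) (allPaths k)))
count-concat (suc m) k P? Q? = begin
  count (suc m + k) PQ?
    ≡⟨ count-suc (m + k) PQ? ⟩
  count (m + k) (PQ? ∘ (false ∷_)) + count (m + k) (PQ? ∘ (true ∷_))
    ≡⟨ cong₂ _+_ (count-concat m k (P? ∘ (false ∷_)) Q?) (count-concat m k (P? ∘ (true ∷_)) Q?) ⟩
  count m (P? ∘ (false ∷_)) * count k Q? + count m (P? ∘ (true ∷_)) * count k Q?
    ≡⟨ *-distribʳ-+ (count k Q?) (count m (P? ∘ (false ∷_))) _ ⟨
  (count m (P? ∘ (false ∷_)) + count m (P? ∘ (true ∷_))) * count k Q?
    ≡⟨ cong (_* count k Q?) (count-suc m P?) ⟨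
  count (suc m) P? * count k Q? ∎
  where
  open ≡-Reasoning
  PQ? = λ p → P? (take (suc m) p) ×-dec Q? (drop (suc m) p)

length-filter-partition : ∀ {A : Set} {P : Pred A ℓ} {Q : Pred A ℓ′} (P? : Decidable P) (Q? : Decidable Q) xs →
  length (filter P? xs) ≡ length (filter (P? ∩? Q?) xs) + length (filter (P? ∩? ∁? Q?) xs)
length-filter-partition P? Q? [] = refl
length-filter-partition P? Q? (x ∷ xs) with P? x | Q? x
... | no _  | _     = length-filter-partition P? Q? xs
... | yes _ | yes _ = cong suc (length-filter-partition P? Q? xs)
... | yes _ | no _  = trans (cong suc (length-filter-partition P? Q? xs)) (sym (+-suc _ _))

count-partition : ∀ n {P : Pred Path ℓ} {Q : Pred Path ℓ′} (P? : Decidable P) (Q? : Decidable Q) →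
  count n P? ≡ count n (P? ∩? Q?) + count n (P? ∩? ∁? Q?)
count-partition n P? Q? = length-filter-partition P? Q? (allPaths n)

take-length-++ : ∀ {A : Set} (xs ys : List A) → take (length xs) (xs ++ ys) ≡ xs
take-length-++ []       ys = refl
take-length-++ (x ∷ xs) ys = cong (x ∷_) (take-length-++ xs ys)

drop-length-++ : ∀ {A : Set} (xs ys : List A) → drop (length xs) (xs ++ ys) ≡ ys
drop-length-++ []       ys = refl
drop-length-++ (x ∷ xs) ys = drop-length-++ xs ys

length-take-+ : ∀ {A : Set} {m k} (xs : List A) → length xs ≡ m + k → length (take m xs) ≡ m
length-take-+ {m = m} {k} xs |xs| = trans (length-take m xs) (m≤n⇒m⊓n≡m (subst (m ≤_) (sym |xs|) (m≤m+n m k)))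

length-drop-+ : ∀ {A : Set} {m k} (xs : List A) → length xs ≡ m + k → length (drop m xs) ≡ k
length-drop-+ {m = m} {k} xs |xs| = trans (length-drop m xs) (trans (cong (_∸ m) |xs|) (m+n∸m≡n m k))

∣∧<⇒≡0 : ∀ {d i} → d ∣ i → i < d → i ≡ 0
∣∧<⇒≡0 {i = zero}  _   _   = refl
∣∧<⇒≡0 {i = suc _} d∣i i<d = contradiction (∣⇒≤ d∣i) (<⇒≱ i<d)

neg-swap : ∀ x y z → x ℤ.+ y ≡ ℤ.- z → z ℤ.+ y ≡ ℤ.- x
neg-swap x y z e = begin
  z ℤ.+ y                  ≡⟨ rearrange x y z ⟩
  (x ℤ.+ y) ℤ.+ (z ℤ.- x)  ≡⟨ cong (λ w → w ℤ.+ (z ℤ.- x)) e ⟩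
  ℤ.- z ℤ.+ (z ℤ.- x)      ≡⟨ cancel z x ⟩
  ℤ.- x                    ∎
  where
  open ≡-Reasoning
  rearrange : ∀ x y z → z ℤ.+ y ≡ (x ℤ.+ y) ℤ.+ (z ℤ.- x)
  rearrange = solve-∀
  cancel : ∀ z x → ℤ.- z ℤ.+ (z ℤ.- x) ≡ ℤ.- x
  cancel = solve-∀

0<i-j⇔j<i : ∀ i j → (0ℤ ℤ.< i ℤ.- j) ⇔ (j ℤ.< i)
0<i-j⇔j<i i j = mk⇔
  (λ 0<i-j → subst₂ ℤ._<_ (ℤᵖ.+-identityˡ j) (minus-plus i j) (ℤᵖ.+-monoˡ-< j 0<i-j))
  (λ j<i → subst (ℤ._< i ℤ.- j) (ℤᵖ.+-inverseʳ j) (ℤᵖ.+-monoˡ-< (ℤ.- j) j<i))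
  where
  minus-plus : ∀ i j → i ℤ.- j ℤ.+ j ≡ i
  minus-plus = solve-∀

module _ (a b : ℕ) where

  weight : Bool → ℤ
  weight false = ℤ.- (ℤ.+ b)
  weight true  = ℤ.+ a

  height : Path → ℤ
  height []      = 0ℤ
  height (s ∷ p) = weight s ℤ.+ height p

  stepLevels : ℤ → Path → List ℤ
  stepLevels z []      = []
  stepLevels z (s ∷ p) = z ∷ stepLevels (z ℤ.+ weight s) p

  levels : ℤ → Path → List ℤ
  levels z []      = [ z ]
  levels z (s ∷ p) = z ∷ levels (z ℤ.+ weight s) p

  height-++ : ∀ p q → height (p ++ q) ≡ height p ℤ.+ height q
  height-++ []      q = sym (ℤᵖ.+-identityˡ (height q))
  height-++ (s ∷ p) q = trans (cong (ℤ._+_ (weight s)) (height-++ p q))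
    (sym (ℤᵖ.+-assoc (weight s) (height p) (height q)))

  height-reverse : ∀ p → height (reverse p) ≡ height p
  height-reverse []      = refl
  height-reverse (s ∷ p) = begin
    height (reverse (s ∷ p))             ≡⟨ cong height (unfold-reverse s p) ⟩
    height (reverse p ∷ʳ s)              ≡⟨ height-++ (reverse p) [ s ] ⟩
    height (reverse p) ℤ.+ height [ s ]  ≡⟨ cong₂ ℤ._+_ (height-reverse p) (ℤᵖ.+-identityʳ (weight s)) ⟩
    height p ℤ.+ weight s                ≡⟨ ℤᵖ.+-comm (height p) (weight s) ⟩
    height (s ∷ p)                       ∎
    where open ≡-Reasoning

  length-stepLevels : ∀ z p → length (stepLevels z p) ≡ length p
  length-stepLevels z []      = refl
  length-stepLevels z (s ∷ p) = cong suc (length-stepLevels (z ℤ.+ weight s) p)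

  stepLevels-++ : ∀ z p q → stepLevels z (p ++ q) ≡ stepLevels z p ++ stepLevels (z ℤ.+ height p) q
  stepLevels-++ z []      q = cong (λ y → stepLevels y q) (sym (ℤᵖ.+-identityʳ z))
  stepLevels-++ z (s ∷ p) q = cong (z ∷_) (trans (stepLevels-++ (z ℤ.+ weight s) p q)
    (cong (λ y → stepLevels (z ℤ.+ weight s) p ++ stepLevels y q) (ℤᵖ.+-assoc z (weight s) (height p))))

  levels-++ : ∀ z p q → levels z (p ++ q) ≡ stepLevels z p ++ levels (z ℤ.+ height p) q
  levels-++ z []      q = cong (λ y → levels y q) (sym (ℤᵖ.+-identityʳ z))
  levels-++ z (s ∷ p) q = cong (z ∷_) (trans (levels-++ (z ℤ.+ weight s) p q)
    (cong (λ y → stepLevels (z ℤ.+ weight s) p ++ levels y q) (ℤᵖ.+-assoc z (weight s) (height p))))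

  levels≡stepLevels∷ʳend : ∀ z p → levels z p ≡ stepLevels z p ∷ʳ (z ℤ.+ height p)
  levels≡stepLevels∷ʳend z p = trans (cong (levels z) (sym (++-identityʳ p))) (levels-++ z p [])

  drop-stepLevels : ∀ z p q → drop (length p) (stepLevels z (p ++ q)) ≡ stepLevels (z ℤ.+ height p) q
  drop-stepLevels z p q = trans (cong (drop (length p)) (stepLevels-++ z p q))
    (subst (λ n → drop n (stepLevels z p ++ rest) ≡ rest) (length-stepLevels z p) (drop-length-++ (stepLevels z p) rest))
    where rest = stepLevels (z ℤ.+ height p) q

  All-levels-head : ∀ {P : ℤ → Set ℓ} z p → All P (levels z p) → P z
  All-levels-head z []      (Pz ∷ _) = Pz
  All-levels-head z (_ ∷ _) (Pz ∷ _) = Pz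

  levels-reverse : ∀ p → levels 0ℤ (reverse p) ≡ reverse (map ℤ.-_ (levels (ℤ.- height p) p))
  levels-reverse p = reflect p 0ℤ (ℤ.- height p) (ℤᵖ.+-inverseˡ (height p))
    where
    open ≡-Reasoning
    reflect : ∀ p z u → u ℤ.+ height p ≡ ℤ.- z → levels z (reverse p) ≡ reverse (map ℤ.-_ (levels u p))
    reflect []      z u e = cong [_] (trans (sym (ℤᵖ.+-identityʳ z)) (neg-swap u 0ℤ z e))
    reflect (s ∷ p) z u e = begin
      levels z (reverse (s ∷ p))
        ≡⟨ cong (levels z) (unfold-reverse s p) ⟩
      levels z (reverse p ∷ʳ s)
        ≡⟨ levels-++ z (reverse p) [ s ] ⟩
      stepLevels z (reverse p) ++ [ z ℤ.+ height (reverse p) ] ++ [ z ℤ.+ height (reverse p) ℤ.+ weight s ]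
        ≡⟨ ++-assoc (stepLevels z (reverse p)) _ _ ⟨
      (stepLevels z (reverse p) ∷ʳ (z ℤ.+ height (reverse p))) ∷ʳ (z ℤ.+ height (reverse p) ℤ.+ weight s)
        ≡⟨ cong₂ _∷ʳ_ (sym (levels≡stepLevels∷ʳend z (reverse p))) last-level ⟩
      levels z (reverse p) ∷ʳ ℤ.- u
        ≡⟨ cong (_∷ʳ ℤ.- u) (reflect p z (u ℤ.+ weight s) (trans (ℤᵖ.+-assoc u (weight s) (height p)) e)) ⟩
      reverse (map ℤ.-_ (levels (u ℤ.+ weight s) p)) ∷ʳ ℤ.- u
        ≡⟨ unfold-reverse (ℤ.- u) (map ℤ.-_ (levels (u ℤ.+ weight s) p)) ⟨
      reverse (map ℤ.-_ (levels u (s ∷ p)))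
        ∎
      where
      last-level : z ℤ.+ height (reverse p) ℤ.+ weight s ≡ ℤ.- u
      last-level = trans (trans (ℤᵖ.+-assoc z _ (weight s)) (cong (λ h → z ℤ.+ (h ℤ.+ weight s)) (height-reverse p)))
        (trans (cong (ℤ._+_ z) (ℤᵖ.+-comm (height p) (weight s))) (neg-swap u (height (s ∷ p)) z e))

  nonneg-reverse : ∀ p → All (ℤ._≤ 0ℤ) (levels (ℤ.- height p) p) →
    All (0ℤ ℤ.≤_) (levels 0ℤ (reverse p))
  nonneg-reverse p nonpos = subst (All (0ℤ ℤ.≤_)) (sym (levels-reverse p))
    (All-resp-↭ (↭-sym (↭-reverse _)) (All.map⁺ (All.map ℤᵖ.neg-mono-≤ nonpos)))

  nonneg-reverse⁻ : ∀ p → All (0ℤ ℤ.≤_) (levels 0ℤ (reverse p)) →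
    All (ℤ._≤ 0ℤ) (levels (ℤ.- height p) p)
  nonneg-reverse⁻ p nonneg = All.map ℤᵖ.neg-cancel-≤
    (All.map⁻ (All-resp-↭ (↭-reverse _) (subst (All (0ℤ ℤ.≤_)) (levels-reverse p) nonneg)))

  nonneg-levels : ∀ σ p → σ ℤ.+ height p ≡ 0ℤ →
    All (0ℤ ℤ.<_) (stepLevels σ p) → All (0ℤ ℤ.≤_) (levels σ p)
  nonneg-levels σ p end positive = subst (All (0ℤ ℤ.≤_)) (sym (levels≡stepLevels∷ʳend σ p))
    (All.∷ʳ⁺ (All.map ℤᵖ.<⇒≤ positive) (ℤᵖ.≤-reflexive (sym end)))

  zero-prefix : ∀ z p → All (0ℤ ℤ.≤_) (stepLevels z p) → ¬ All (0ℤ ℤ.<_) (stepLevels z p) →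
                ∃[ i ] i < length p × z ℤ.+ height (take i p) ≡ 0ℤ
  zero-prefix z []      _            ¬positive = contradiction [] ¬positive
  zero-prefix z (s ∷ p) (0≤z ∷ rest) ¬positive with 0ℤ <? z
  ... | yes 0<z = let i , i<|p| , at-zero = zero-prefix (z ℤ.+ weight s) p rest (¬positive ∘ (0<z ∷_))
                  in suc i , s≤s i<|p| , trans (sym (ℤᵖ.+-assoc z (weight s) (height (take i p)))) at-zero
  ... | no 0≮z  = 0 , s≤s z≤n , trans (ℤᵖ.+-identityʳ z) (ℤᵖ.≤-antisym (ℤᵖ.≮⇒≥ 0≮z) 0≤z)

  -- Splitting a walk by the sign of the levels its steps start at

  above below : ℤ → Path → Path
  above z []      = []
  above z (s ∷ p) with 0ℤ <? z
  ... | yes _ = s ∷ above (z ℤ.+ weight s) p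
  ... | no  _ = above (z ℤ.+ weight s) p
  below z []      = []
  below z (s ∷ p) with 0ℤ <? z
  ... | yes _ = below (z ℤ.+ weight s) p
  ... | no  _ = s ∷ below (z ℤ.+ weight s) p

  merge : ℤ → Path → Path → Path
  merge z []      q       = q
  merge z (s ∷ p) []      = s ∷ p
  merge z (s ∷ p) (t ∷ q) =
    if does (0ℤ <? z) then s ∷ merge (z ℤ.+ weight s) p (t ∷ q) else t ∷ merge (z ℤ.+ weight t) (s ∷ p) q

  split-accept : ∀ {z} s p → 0ℤ ℤ.< z →
    above z (s ∷ p) ≡ s ∷ above (z ℤ.+ weight s) p × below z (s ∷ p) ≡ below (z ℤ.+ weight s) p
  split-accept {z} s p 0<z with 0ℤ <? z
  ... | yes _   = refl , refl
  ... | no 0≮z = contradiction 0<z 0≮z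

  split-reject : ∀ {z} s p → ¬ 0ℤ ℤ.< z →
    above z (s ∷ p) ≡ above (z ℤ.+ weight s) p × below z (s ∷ p) ≡ s ∷ below (z ℤ.+ weight s) p
  split-reject {z} s p 0≮z with 0ℤ <? z
  ... | yes 0<z = contradiction 0<z 0≮z
  ... | no _    = refl , refl

  merge-[]ʳ : ∀ z p → merge z p [] ≡ p
  merge-[]ʳ z []      = refl
  merge-[]ʳ z (s ∷ p) = refl

  merge-accept : ∀ {z} s p q → 0ℤ ℤ.< z → merge z (s ∷ p) q ≡ s ∷ merge (z ℤ.+ weight s) p q
  merge-accept {z} s p []      0<z = cong (s ∷_) (sym (merge-[]ʳ _ p))
  merge-accept {z} s p (t ∷ q) 0<z with 0ℤ <? z
  ... | yes _   = refl
  ... | no 0≮z = contradiction 0<z 0≮z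

  merge-reject : ∀ {z} p t q → ¬ 0ℤ ℤ.< z → merge z p (t ∷ q) ≡ t ∷ merge (z ℤ.+ weight t) p q
  merge-reject {z} []      t q 0≮z = refl
  merge-reject {z} (s ∷ p) t q 0≮z with 0ℤ <? z
  ... | yes 0<z = contradiction 0<z 0≮z
  ... | no _    = refl

  merge-split : ∀ z p → merge z (above z p) (below z p) ≡ p
  merge-split z []      = refl
  merge-split z (s ∷ p) with 0ℤ <? z
  ... | yes 0<z = trans (merge-accept s (above z′ p) (below z′ p) 0<z) (cong (s ∷_) (merge-split z′ p))
    where z′ = z ℤ.+ weight s
  ... | no 0≮z  = trans (merge-reject (above z′ p) s (below z′ p) 0≮z) (cong (s ∷_) (merge-split z′ p))
    where z′ = z ℤ.+ weight s

  length-split : ∀ z p → length (above z p) + length (below z p) ≡ length p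
  length-split z []      = refl
  length-split z (s ∷ p) with 0ℤ <? z
  ... | yes _ = cong suc (length-split (z ℤ.+ weight s) p)
  ... | no  _ = trans (+-suc _ _) (cong suc (length-split (z ℤ.+ weight s) p))

  height-split : ∀ z p → height (above z p) ℤ.+ height (below z p) ≡ height p
  height-split z []      = refl
  height-split z (s ∷ p) with 0ℤ <? z
  ... | yes _ = trans (ℤᵖ.+-assoc (weight s) _ _) (cong (ℤ._+_ (weight s)) (height-split (z ℤ.+ weight s) p))
  ... | no  _ = trans (exchange (height (above _ p)) (weight s) _)
                      (cong (ℤ._+_ (weight s)) (height-split (z ℤ.+ weight s) p))
    where
    exchange : ∀ x y u → x ℤ.+ (y ℤ.+ u) ≡ y ℤ.+ (x ℤ.+ u)
    exchange = solve-∀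

  split-of-above : ∀ z p → All (0ℤ ℤ.<_) (stepLevels z p) → above z p ≡ p × below z p ≡ []
  split-of-above z []      []            = refl , refl
  split-of-above z (s ∷ p) (0<z ∷ rest) with 0ℤ <? z
  ... | yes _   = map₁ (cong (s ∷_)) (split-of-above (z ℤ.+ weight s) p rest)
  ... | no 0≮z = contradiction 0<z 0≮z

  split-of-below : ∀ z p → All (ℤ._≤ 0ℤ) (levels z p) → above z p ≡ [] × below z p ≡ p
  split-of-below z []      _             = refl , refl
  split-of-below z (s ∷ p) (z≤0 ∷ rest) with 0ℤ <? z
  ... | yes 0<z = contradiction z≤0 (ℤᵖ.<⇒≱ 0<z)
  ... | no _    = map₂ (cong (s ∷_)) (split-of-below (z ℤ.+ weight s) p rest)

  -- Both recursive calls are made in the with-clause, where the termination checker can see them.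
  split-merge : ∀ {σ τ z} p q → σ ℤ.+ height p ≡ 0ℤ → τ ℤ.+ height q ≡ 0ℤ → z ≡ σ ℤ.+ τ →
    All (0ℤ ℤ.<_) (stepLevels σ p) → All (ℤ._≤ 0ℤ) (levels τ q) →
    above z (merge z p q) ≡ p × below z (merge z p q) ≡ q
  split-merge {σ} {τ} {z} [] q σ-end _ z≡ _ q-below =
    split-of-below z q (subst (λ y → All (ℤ._≤ 0ℤ) (levels y q)) (sym z≡τ) q-below)
    where
    z≡τ : z ≡ τ
    z≡τ = trans z≡ (trans (cong (ℤ._+ τ) (trans (sym (ℤᵖ.+-identityʳ σ)) σ-end)) (ℤᵖ.+-identityˡ τ))
  split-merge {σ} {τ} {z} (s ∷ p) [] _ τ-end z≡ p-above _ =
    split-of-above z (s ∷ p) (subst (λ y → All (0ℤ ℤ.<_) (stepLevels y (s ∷ p))) (sym z≡σ) p-above)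
    where
    z≡σ : z ≡ σ
    z≡σ = trans z≡ (trans (cong (ℤ._+_ σ) (trans (sym (ℤᵖ.+-identityʳ τ)) τ-end)) (ℤᵖ.+-identityʳ σ))
  split-merge {σ} {τ} {z} (s ∷ p) (t ∷ q) σ-end τ-end refl p-above@(_ ∷ p-above′) q-below@(_ ∷ q-below′)
    with 0ℤ <? z
       | split-merge p (t ∷ q) (trans (ℤᵖ.+-assoc σ (weight s) (height p)) σ-end) τ-end
           (swap σ τ (weight s)) p-above′ q-below
       | split-merge (s ∷ p) q σ-end (trans (ℤᵖ.+-assoc τ (weight t) (height q)) τ-end)
           (ℤᵖ.+-assoc σ τ (weight t)) p-above q-below′
    where
    swap : ∀ x y u → x ℤ.+ y ℤ.+ u ≡ x ℤ.+ u ℤ.+ y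
    swap = solve-∀
  ... | yes 0<z | above≡p , below≡tq | _ =
    let above≡ , below≡ = split-accept s (merge (z ℤ.+ weight s) p (t ∷ q)) 0<z
    in trans above≡ (cong (s ∷_) above≡p) , trans below≡ below≡tq
  ... | no 0≮z  | _ | above≡sp , below≡q =
    let above≡ , below≡ = split-reject t (merge (z ℤ.+ weight t) (s ∷ p) q) 0≮z
    in trans above≡ above≡sp , trans below≡ (cong (t ∷_) below≡q)

  end-∷ : ∀ z s p → z ℤ.+ height (s ∷ p) ≡ 0ℤ → z ℤ.+ weight s ℤ.+ height p ≡ 0ℤ
  end-∷ z s p e = trans (ℤᵖ.+-assoc z (weight s) (height p)) e

  start-∷ : ∀ s p → ℤ.- height (s ∷ p) ℤ.+ weight s ≡ ℤ.- height p
  start-∷ s p = cancel (weight s) (height p)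
    where
    cancel : ∀ w h → ℤ.- (w ℤ.+ h) ℤ.+ w ≡ ℤ.- h
    cancel = solve-∀

  unshift : ∀ z w → z ℤ.+ w ℤ.+ ℤ.- w ≡ z
  unshift = solve-∀

  neg-height-∷ : ∀ s p → ℤ.- height p ℤ.+ ℤ.- weight s ≡ ℤ.- height (s ∷ p)
  neg-height-∷ s p = trans (ℤᵖ.+-comm (ℤ.- height p) (ℤ.- weight s))
    (sym (ℤᵖ.neg-distrib-+ (weight s) (height p)))

  -- Placed so that they end at level 0, the steps taken above 0 start strictly above 0, and the
  -- steps taken at or below 0 never rise above 0.
  above-invariant : ∀ z p → z ℤ.+ height p ≡ 0ℤ →
    0ℤ ℤ.≤ ℤ.- height (above z p) × z ℤ.≤ ℤ.- height (above z p) ×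
    All (0ℤ ℤ.<_) (stepLevels (ℤ.- height (above z p)) (above z p))
  above-invariant z []      e = ℤᵖ.≤-refl , ℤᵖ.≤-reflexive (trans (sym (ℤᵖ.+-identityʳ z)) e) , []
  above-invariant z (s ∷ p) e with 0ℤ <? z | above-invariant (z ℤ.+ weight s) p (end-∷ z s p e)
  ... | yes 0<z | _ , z′≤σ′ , rest =
    ℤᵖ.<⇒≤ 0<σ , z≤σ , 0<σ ∷ subst (λ y → All (0ℤ ℤ.<_) (stepLevels y A)) (sym (start-∷ s A)) rest
    where
    A = above (z ℤ.+ weight s) p
    z≤σ : z ℤ.≤ ℤ.- height (s ∷ A)
    z≤σ = subst₂ ℤ._≤_ (unshift z (weight s)) (neg-height-∷ s A) (ℤᵖ.+-monoˡ-≤ (ℤ.- weight s) z′≤σ′)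
    0<σ : 0ℤ ℤ.< ℤ.- height (s ∷ A)
    0<σ = ℤᵖ.<-≤-trans 0<z z≤σ
  ... | no 0≮z  | 0≤σ′ , _ , rest = 0≤σ′ , ℤᵖ.≤-trans (ℤᵖ.≮⇒≥ 0≮z) 0≤σ′ , rest

  below-invariant : ∀ z p → z ℤ.+ height p ≡ 0ℤ →
    ℤ.- height (below z p) ℤ.≤ z × All (ℤ._≤ 0ℤ) (levels (ℤ.- height (below z p)) (below z p))
  below-invariant z []      e = ℤᵖ.≤-reflexive (sym (trans (sym (ℤᵖ.+-identityʳ z)) e)) , ℤᵖ.≤-refl ∷ []
  below-invariant z (s ∷ p) e with 0ℤ <? z | below-invariant (z ℤ.+ weight s) p (end-∷ z s p e)
  ... | yes 0<z | _ , rest = ℤᵖ.≤-trans (All-levels-head _ _ rest) (ℤᵖ.<⇒≤ 0<z) , rest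
  ... | no 0≮z  | τ′≤z′ , rest =
    τ≤z , ℤᵖ.≤-trans τ≤z (ℤᵖ.≮⇒≥ 0≮z)
        ∷ subst (λ y → All (ℤ._≤ 0ℤ) (levels y B)) (sym (start-∷ s B)) rest
    where
    B = below (z ℤ.+ weight s) p
    τ≤z : ℤ.- height (s ∷ B) ℤ.≤ z
    τ≤z = subst₂ ℤ._≤_ (neg-height-∷ s B) (unshift z (weight s)) (ℤᵖ.+-monoˡ-≤ (ℤ.- weight s) τ′≤z′)

  positives-above : ∀ z p → z ℤ.+ height p ≡ 0ℤ → length (filter (0ℤ <?_) (levels z p)) ≡ length (above z p)
  positives-above z []      e with 0ℤ <? z
  ... | yes 0<z = contradiction (sym (trans (sym (ℤᵖ.+-identityʳ z)) e)) (ℤᵖ.<⇒≢ 0<z)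
  ... | no _    = refl
  positives-above z (s ∷ p) e with 0ℤ <? z
  ... | yes _ = cong suc (positives-above (z ℤ.+ weight s) p (end-∷ z s p e))
  ... | no _  = positives-above (z ℤ.+ weight s) p (end-∷ z s p e)

  -- A Chung-Feller bijection

  HasFlaws : ℕ → Pred Path 0ℓ
  HasFlaws k p = height p ≡ 0ℤ × length (above 0ℤ p) ≡ k

  hasFlaws? : ∀ k → Decidable (HasFlaws k)
  hasFlaws? k p = (height p ℤᵖ.≟ 0ℤ) ×-dec (length (above 0ℤ p) ℕ.≟ k)

  -- D is a nonnegative bridge that does not visit level 0 at indices m, m + 1, ... except at its end.
  ZeroFreeFrom : ℕ → Pred Path 0ℓ
  ZeroFreeFrom m D = height D ≡ 0ℤ × All (0ℤ ℤ.≤_) (levels 0ℤ D) × All (0ℤ ℤ.<_) (drop m (stepLevels 0ℤ D))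

  zeroFreeFrom? : ∀ m → Decidable (ZeroFreeFrom m)
  zeroFreeFrom? m D = (height D ℤᵖ.≟ 0ℤ) ×-dec All.all? (0ℤ ≤?_) (levels 0ℤ D)
                                         ×-dec All.all? (0ℤ <?_) (drop m (stepLevels 0ℤ D))

  toBridge : Path → Path
  toBridge p = reverse (below 0ℤ p) ++ above 0ℤ p

  fromBridge : ℕ → Path → Path
  fromBridge l D = merge 0ℤ (drop l D) (reverse (take l D))

  module FromFlawed {l k p} (p-flawed : Sized (l + k) (HasFlaws k) p) where

    A = above 0ℤ p
    B = below 0ℤ p

    |p|≡l+k : length p ≡ l + k
    |p|≡l+k = proj₁ p-flawed
    hp≡0 : height p ≡ 0ℤ
    hp≡0 = proj₁ (proj₂ p-flawed)
    |A|≡k : length A ≡ k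
    |A|≡k = proj₂ (proj₂ p-flawed)

    |revB|≡l : length (reverse B) ≡ l
    |revB|≡l = trans (length-reverse B) (+-cancelʳ-≡ k (length B) l (begin
      length B + k        ≡⟨ +-comm (length B) k ⟩
      k + length B        ≡⟨ cong (_+ length B) |A|≡k ⟨
      length A + length B ≡⟨ length-split 0ℤ p ⟩
      length p            ≡⟨ |p|≡l+k ⟩
      l + k               ∎))
      where open ≡-Reasoning

    ends-at-0 : 0ℤ ℤ.+ height p ≡ 0ℤ
    ends-at-0 = trans (ℤᵖ.+-identityˡ (height p)) hp≡0

    A-starts-above : All (0ℤ ℤ.<_) (stepLevels (ℤ.- height A) A)
    A-starts-above = proj₂ (proj₂ (above-invariant 0ℤ p ends-at-0))

    A-start : 0ℤ ℤ.+ height (reverse B) ≡ ℤ.- height A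
    A-start = trans (cong (ℤ._+_ 0ℤ) (height-reverse B))
      (neg-swap (height A) (height B) 0ℤ (trans (height-split 0ℤ p) hp≡0))

    A-steps : drop l (stepLevels 0ℤ (toBridge p)) ≡ stepLevels (ℤ.- height A) A
    A-steps = begin
      drop l (stepLevels 0ℤ (toBridge p))
        ≡⟨ cong (λ n → drop n (stepLevels 0ℤ (toBridge p))) |revB|≡l ⟨
      drop (length (reverse B)) (stepLevels 0ℤ (toBridge p))
        ≡⟨ drop-stepLevels 0ℤ (reverse B) A ⟩
      stepLevels (0ℤ ℤ.+ height (reverse B)) A
        ≡⟨ cong (λ σ → stepLevels σ A) A-start ⟩
      stepLevels (ℤ.- height A) A
        ∎
      where open ≡-Reasoning

    revB-nonneg : All (0ℤ ℤ.≤_) (stepLevels 0ℤ (reverse B))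
    revB-nonneg = proj₁ (All.∷ʳ⁻ (subst (All (0ℤ ℤ.≤_)) (levels≡stepLevels∷ʳend 0ℤ (reverse B))
      (nonneg-reverse B (proj₂ (below-invariant 0ℤ p ends-at-0)))))

    bridge : Sized (l + k) (ZeroFreeFrom l) (toBridge p)
    bridge = length-bridge , height-bridge , nonneg-bridge , zero-free-bridge
      where
      length-bridge : length (toBridge p) ≡ l + k
      length-bridge = trans (length-++ (reverse B)) (cong₂ _+_ |revB|≡l |A|≡k)
      height-bridge : height (toBridge p) ≡ 0ℤ
      height-bridge = trans (height-++ (reverse B) A) (trans (cong (ℤ._+ height A) (height-reverse B))
        (trans (ℤᵖ.+-comm (height B) (height A)) (trans (height-split 0ℤ p) hp≡0)))
      nonneg-bridge : All (0ℤ ℤ.≤_) (levels 0ℤ (toBridge p))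
      nonneg-bridge = subst (All (0ℤ ℤ.≤_)) (sym (levels-++ 0ℤ (reverse B) A)) (All.++⁺ revB-nonneg
        (subst (λ σ → All (0ℤ ℤ.≤_) (levels σ A)) (sym A-start)
          (nonneg-levels (ℤ.- height A) A (ℤᵖ.+-inverseˡ (height A)) A-starts-above)))
      zero-free-bridge : All (0ℤ ℤ.<_) (drop l (stepLevels 0ℤ (toBridge p)))
      zero-free-bridge = subst (All (0ℤ ℤ.<_)) (sym A-steps) A-starts-above

    fromBridge-toBridge : fromBridge l (toBridge p) ≡ p
    fromBridge-toBridge = begin
      merge 0ℤ (drop l (reverse B ++ A)) (reverse (take l (reverse B ++ A)))
        ≡⟨ cong (λ n → merge 0ℤ (drop n (reverse B ++ A)) (reverse (take n (reverse B ++ A)))) |revB|≡l ⟨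
      merge 0ℤ (drop (length (reverse B)) (reverse B ++ A)) (reverse (take (length (reverse B)) (reverse B ++ A)))
        ≡⟨ cong₂ (merge 0ℤ) (drop-length-++ (reverse B) A)
                 (trans (cong reverse (take-length-++ (reverse B) A)) (reverse-involutive B)) ⟩
      merge 0ℤ A B
        ≡⟨ merge-split 0ℤ p ⟩
      p ∎
      where open ≡-Reasoning

  module FromBridge {l k D} (D-bridge : Sized (l + k) (ZeroFreeFrom l) D) where

    X = take l D
    Y = drop l D
    M = fromBridge l D

    |D|≡l+k : length D ≡ l + k
    |D|≡l+k = proj₁ D-bridge
    hD≡0 : height D ≡ 0ℤ
    hD≡0 = proj₁ (proj₂ D-bridge)
    D-nonneg : All (0ℤ ℤ.≤_) (levels 0ℤ D)
    D-nonneg = proj₁ (proj₂ (proj₂ D-bridge))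
    D-zero-free : All (0ℤ ℤ.<_) (drop l (stepLevels 0ℤ D))
    D-zero-free = proj₂ (proj₂ (proj₂ D-bridge))

    |X|≡l : length X ≡ l
    |X|≡l = length-take-+ D |D|≡l+k
    |Y|≡k : length Y ≡ k
    |Y|≡k = length-drop-+ D |D|≡l+k

    D≡X++Y : X ++ Y ≡ D
    D≡X++Y = take++drop≡id l D

    hX+hY≡0 : height X ℤ.+ height Y ≡ 0ℤ
    hX+hY≡0 = trans (sym (height-++ X Y)) (trans (cong height D≡X++Y) hD≡0)

    Y-start : 0ℤ ℤ.+ height X ≡ ℤ.- height Y
    Y-start = neg-swap (height Y) (height X) 0ℤ (trans (ℤᵖ.+-comm (height Y) (height X)) hX+hY≡0)

    Y-steps : drop l (stepLevels 0ℤ D) ≡ stepLevels (ℤ.- height Y) Y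
    Y-steps = begin
      drop l (stepLevels 0ℤ D)                ≡⟨ cong (λ q → drop l (stepLevels 0ℤ q)) D≡X++Y ⟨
      drop l (stepLevels 0ℤ (X ++ Y))         ≡⟨ cong (λ n → drop n (stepLevels 0ℤ (X ++ Y))) |X|≡l ⟨
      drop (length X) (stepLevels 0ℤ (X ++ Y)) ≡⟨ drop-stepLevels 0ℤ X Y ⟩
      stepLevels (0ℤ ℤ.+ height X) Y          ≡⟨ cong (λ σ → stepLevels σ Y) Y-start ⟩
      stepLevels (ℤ.- height Y) Y             ∎
      where open ≡-Reasoning

    X-nonneg : All (0ℤ ℤ.≤_) (levels 0ℤ X)
    X-nonneg = subst (All (0ℤ ℤ.≤_)) (sym (levels≡stepLevels∷ʳend 0ℤ X))
      (All.∷ʳ⁺ (proj₁ split-levels) (All-levels-head (0ℤ ℤ.+ height X) Y (proj₂ split-levels)))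
      where
      split-levels = All.++⁻ (stepLevels 0ℤ X) (subst (All (0ℤ ℤ.≤_)) (levels-++ 0ℤ X Y)
        (subst (λ q → All (0ℤ ℤ.≤_) (levels 0ℤ q)) (sym D≡X++Y) D-nonneg))

    revX-below : All (ℤ._≤ 0ℤ) (levels (ℤ.- height (reverse X)) (reverse X))
    revX-below = nonneg-reverse⁻ (reverse X)
      (subst (λ q → All (0ℤ ℤ.≤_) (levels 0ℤ q)) (sym (reverse-involutive X)) X-nonneg)

    split-M : above 0ℤ M ≡ Y × below 0ℤ M ≡ reverse X
    split-M = split-merge Y (reverse X) (ℤᵖ.+-inverseˡ (height Y)) (ℤᵖ.+-inverseˡ (height (reverse X)))
      (sym (trans (cong (ℤ._+_ (ℤ.- height Y)) (cong ℤ.-_ (height-reverse X))) (neg-sum (height X) (height Y) hX+hY≡0)))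
      (subst (All (0ℤ ℤ.<_)) Y-steps D-zero-free) revX-below
      where
      neg-sum : ∀ x y → x ℤ.+ y ≡ 0ℤ → ℤ.- y ℤ.+ ℤ.- x ≡ 0ℤ
      neg-sum x y e = trans (ℤᵖ.+-comm (ℤ.- y) (ℤ.- x)) (trans (sym (ℤᵖ.neg-distrib-+ x y)) (cong ℤ.-_ e))

    flawed : Sized (l + k) (HasFlaws k) M
    flawed = length-M , height-M , trans (cong length (proj₁ split-M)) |Y|≡k
      where
      open ≡-Reasoning
      length-M : length M ≡ l + k
      length-M = begin
        length M                                   ≡⟨ length-split 0ℤ M ⟨
        length (above 0ℤ M) + length (below 0ℤ M)
          ≡⟨ cong₂ (λ q r → length q + length r) (proj₁ split-M) (proj₂ split-M) ⟩
        length Y + length (reverse X)              ≡⟨ cong₂ _+_ |Y|≡k (trans (length-reverse X) |X|≡l) ⟩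
        k + l                                      ≡⟨ +-comm k l ⟩
        l + k                                      ∎
      height-M : height M ≡ 0ℤ
      height-M = begin
        height M                                     ≡⟨ height-split 0ℤ M ⟨
        height (above 0ℤ M) ℤ.+ height (below 0ℤ M)
          ≡⟨ cong₂ (λ q r → height q ℤ.+ height r) (proj₁ split-M) (proj₂ split-M) ⟩
        height Y ℤ.+ height (reverse X)              ≡⟨ cong (ℤ._+_ (height Y)) (height-reverse X) ⟩
        height Y ℤ.+ height X                        ≡⟨ ℤᵖ.+-comm (height Y) (height X) ⟩
        height X ℤ.+ height Y                        ≡⟨ hX+hY≡0 ⟩
        0ℤ                                           ∎

    toBridge-fromBridge : toBridge M ≡ D
    toBridge-fromBridge = begin
      reverse (below 0ℤ M) ++ above 0ℤ M  ≡⟨ cong₂ (λ q r → reverse q ++ r) (proj₂ split-M) (proj₁ split-M) ⟩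
      reverse (reverse X) ++ Y            ≡⟨ cong (_++ Y) (reverse-involutive X) ⟩
      X ++ Y                              ≡⟨ D≡X++Y ⟩
      D                                   ∎
      where open ≡-Reasoning

  chung-feller : ∀ l k {n} → l + k ≡ n → count n (hasFlaws? k) ≡ count n (zeroFreeFrom? l)
  chung-feller l k refl = count-bijection (hasFlaws? k) (zeroFreeFrom? l) toBridge (fromBridge l)
    (λ {p} → FromFlawed.bridge {l} {k} {p}) (λ {D} → FromBridge.flawed {l} {k} {D})
    (λ {p} → FromFlawed.fromBridge-toBridge {l} {k} {p}) (λ {D} → FromBridge.toBridge-fromBridge {l} {k} {D})

  -- From lattice points to levels

  diagonal-length : Coprime a b → 0 < a → ∀ x y → y * a ≡ x * b → (a + b) ∣ x + y
  diagonal-length cop 0<a x y ya≡xb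
    with divides q x≡qa ← coprime-divisor cop (divides y (trans (*-comm b x) (sym ya≡xb))) =
    divides q (trans (cong₂ _+_ x≡qa y≡qb) (sym (*-distribˡ-+ q a b)))
    where
    instance _ = >-nonZero 0<a
    y≡qb : y ≡ q * b
    y≡qb = *-cancelʳ-≡ y (q * b) a (begin
      y * a        ≡⟨ ya≡xb ⟩
      x * b        ≡⟨ cong (_* b) x≡qa ⟩
      q * a * b    ≡⟨ *-assoc q a b ⟩
      q * (a * b)  ≡⟨ cong (q *_) (*-comm a b) ⟩
      q * (b * a)  ≡⟨ *-assoc q b a ⟨
      q * b * a    ∎)
      where open ≡-Reasoning

  diagonal-point : 0 < a + b → ∀ {x y} h → y * a ≡ x * b → x + y ≡ h * a + h * b → x ≡ h * a × y ≡ h * b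
  diagonal-point 0<a+b {x} {y} h ya≡xb x+y≡ =
    x≡ha , +-cancelˡ-≡ (h * a) y (h * b) (subst (λ u → u + y ≡ h * a + h * b) x≡ha x+y≡)
    where
    instance _ = >-nonZero 0<a+b
    x≡ha : x ≡ h * a
    x≡ha = *-cancelʳ-≡ x (h * a) (a + b) (begin
      x * (a + b)          ≡⟨ *-distribˡ-+ x a b ⟩
      x * a + x * b        ≡⟨ cong (x * a +_) ya≡xb ⟨
      x * a + y * a        ≡⟨ *-distribʳ-+ a x y ⟨
      (x + y) * a          ≡⟨ cong (_* a) x+y≡ ⟩
      (h * a + h * b) * a  ≡⟨ cong (_* a) (*-distribˡ-+ h a b) ⟨
      h * (a + b) * a      ≡⟨ *-assoc h (a + b) a ⟩
      h * ((a + b) * a)    ≡⟨ cong (h *_) (*-comm (a + b) a) ⟩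
      h * (a * (a + b))    ≡⟨ *-assoc h a (a + b) ⟨
      h * a * (a + b)      ∎)
      where open ≡-Reasoning

  level : Point → ℤ
  level (x , y) = ℤ.+ (y * a) ℤ.- ℤ.+ (x * b)

  level-step : ∀ pt s → level (step pt s) ≡ level pt ℤ.+ weight s
  level-step (x , y) false =
    trans (cong (λ u → ℤ.+ (y * a) ℤ.- u) (ℤᵖ.pos-+ b (x * b))) (east (ℤ.+ (y * a)) (ℤ.+ (x * b)) (ℤ.+ b))
    where
    east : ∀ Y X B → Y ℤ.- (B ℤ.+ X) ≡ Y ℤ.- X ℤ.+ ℤ.- B
    east = solve-∀
  level-step (x , y) true =
    trans (cong (λ u → u ℤ.- ℤ.+ (x * b)) (ℤᵖ.pos-+ a (y * a))) (north (ℤ.+ (y * a)) (ℤ.+ (x * b)) (ℤ.+ a))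
    where
    north : ∀ Y X A → A ℤ.+ Y ℤ.- X ≡ Y ℤ.- X ℤ.+ A
    north = solve-∀

  levels-points : ∀ pt p → map level (scanl step pt p) ≡ levels (level pt) p
  levels-points pt []      = refl
  levels-points pt (s ∷ p) = cong (level pt ∷_)
    (trans (levels-points (step pt s) p) (cong (λ z → levels z p) (level-step pt s)))

  level-endpoint : ∀ pt p → level (foldl step pt p) ≡ level pt ℤ.+ height p
  level-endpoint pt []      = sym (ℤᵖ.+-identityʳ (level pt))
  level-endpoint pt (s ∷ p) = trans (level-endpoint (step pt s) p)
    (trans (cong (ℤ._+ height p) (level-step pt s)) (ℤᵖ.+-assoc (level pt) (weight s) (height p)))

  endpoint-level : ∀ p → level (endpoint p) ≡ height p
  endpoint-level p = trans (level-endpoint (0 , 0) p) (ℤᵖ.+-identityˡ (height p))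

  size : Point → ℕ
  size (x , y) = x + y

  size-endpoint : ∀ pt p → size (foldl step pt p) ≡ size pt + length p
  size-endpoint pt [] = sym (+-identityʳ (size pt))
  size-endpoint (x , y) (false ∷ p) = trans (size-endpoint (suc x , y) p) (sym (+-suc (x + y) (length p)))
  size-endpoint (x , y) (true ∷ p) = trans (size-endpoint (x , suc y) p)
    (trans (cong (_+ length p) (+-suc x y)) (sym (+-suc (x + y) (length p))))

  level≡0⇒diagonal : ∀ x y → level (x , y) ≡ 0ℤ → y * a ≡ x * b
  level≡0⇒diagonal x y e = ℤᵖ.+-injective (ℤᵖ.i-j≡0⇒i≡j (ℤ.+ (y * a)) (ℤ.+ (x * b)) e)

  endpoint-diagonal : ∀ p → height p ≡ 0ℤ → proj₂ (endpoint p) * a ≡ proj₁ (endpoint p) * b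
  endpoint-diagonal p h≡0 =
    level≡0⇒diagonal (proj₁ (endpoint p)) (proj₂ (endpoint p)) (trans (endpoint-level p) h≡0)

  flaw⇔positive-level : ∀ {h} → 0 < h → ∀ pt → IsFlaw a b h pt ⇔ (0ℤ ℤ.< level pt)
  flaw⇔positive-level {h} 0<h (x , y) = mk⇔
    (λ flaw → from (0<i-j⇔j<i _ _) (ℤ.+<+ (*-cancelˡ-< h (x * b) (y * a) (subst₂ _<_ (pull x b) (pull y a) flaw))))
    (λ 0<level → subst₂ _<_ (sym (pull x b)) (sym (pull y a)) (*-monoʳ-< h (ℤᵖ.drop‿+<+ (to (0<i-j⇔j<i _ _) 0<level))))
    where
    open Equivalence
    instance _ = >-nonZero 0<h
    pull : ∀ u v → u * (h * v) ≡ h * (u * v)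
    pull u v = trans (sym (*-assoc u h v)) (trans (cong (_* v) (*-comm u h)) (*-assoc h u v))

  flaws≡positive-levels : ∀ {h} → 0 < h → ∀ p → flaws a b h p ≡ length (filter (0ℤ <?_) (levels 0ℤ p))
  flaws≡positive-levels {h} 0<h p = begin
    length (filter (isFlaw? a b h) (points p))
      ≡⟨ cong length (filter-≐ (isFlaw? a b h) ((0ℤ <?_) ∘ level) flaw≐positive (points p)) ⟩
    length (filter ((0ℤ <?_) ∘ level) (points p))
      ≡⟨ length-map level (filter ((0ℤ <?_) ∘ level) (points p)) ⟨
    length (map level (filter ((0ℤ <?_) ∘ level) (points p)))
      ≡⟨ cong length (filter-map (0ℤ <?_) level (points p)) ⟨
    length (filter (0ℤ <?_) (map level (points p)))
      ≡⟨ cong (length ∘ filter (0ℤ <?_)) (levels-points (0 , 0) p) ⟩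
    length (filter (0ℤ <?_) (levels 0ℤ p)) ∎
    where
    open ≡-Reasoning
    open Equivalence
    flaw≐positive = (λ {pt} → to (flaw⇔positive-level 0<h pt)) , (λ {pt} → from (flaw⇔positive-level 0<h pt))

  endpoint⇔balanced : 0 < a + b → ∀ h p → length p ≡ h * a + h * b →
    (endpoint p ≡ (h * a , h * b)) ⇔ (height p ≡ 0ℤ)
  endpoint⇔balanced 0<a+b h p |p| = mk⇔
    (λ e → trans (sym (endpoint-level p)) (trans (cong level e) on-diagonal))
    (λ h≡0 → let x≡ , y≡ = diagonal-point 0<a+b h (endpoint-diagonal p h≡0) (trans (size-endpoint (0 , 0) p) |p|)
             in cong₂ _,_ x≡ y≡)
    where
    on-diagonal : level (h * a , h * b) ≡ 0ℤ
    on-diagonal = ℤᵖ.i≡j⇒i-j≡0 (cong ℤ.+_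
      (trans (*-assoc h b a) (trans (cong (h *_) (*-comm b a)) (sym (*-assoc h a b)))))

  μ-as-count : 0 < a + b → ∀ j h → 0 < h → μ a b j h ≡ count (h * (a + b)) (hasFlaws? (j * (a + b)))
  μ-as-count 0<a+b j h 0<h = trans (count-cong (inN? a b k h) (hasFlaws? k) (λ {p} → InN⇔HasFlaws {p}))
                                   (cong (λ n → count n (hasFlaws? k)) (sym (*-distribˡ-+ h a b)))
    where
    k = j * (a + b)
    InN⇔HasFlaws : ∀ {p} → length p ≡ h * a + h * b → InN a b k h p ⇔ HasFlaws k p
    InN⇔HasFlaws {p} |p| = mk⇔
      (λ (e , f) → let h≡0 = to (endpoint⇔balanced 0<a+b h p |p|) e in h≡0 , trans (sym (flaws≡above h≡0)) f)
      (λ (h≡0 , c) → from (endpoint⇔balanced 0<a+b h p |p|) h≡0 , trans (flaws≡above h≡0) c)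
      where
      open Equivalence
      flaws≡above : height p ≡ 0ℤ → flaws a b h p ≡ length (above 0ℤ p)
      flaws≡above h≡0 = trans (flaws≡positive-levels 0<h p)
        (positives-above 0ℤ p (trans (ℤᵖ.+-identityˡ (height p)) h≡0))

  -- Splitting a bridge at its last return to level 0

  ZeroFreeFrom-mono : ∀ m c {D} → ZeroFreeFrom m D → ZeroFreeFrom (m + c) D
  ZeroFreeFrom-mono m c (balanced , nonneg , zero-free) =
    balanced , nonneg , subst (All (0ℤ ℤ.<_)) (drop-drop m c _) (All.drop⁺ c zero-free)

  ZeroFreeFrom-++ : ∀ X E c → height X ≡ 0ℤ →
    ZeroFreeFrom (length X + c) (X ++ E) ⇔ (ZeroFreeFrom (length X) X × ZeroFreeFrom c E)
  ZeroFreeFrom-++ X E c hX≡0 = mk⇔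
    (λ (hXE≡0 , nonneg , zero-free) →
      let nonnegX , nonnegE = All.++⁻ (stepLevels 0ℤ X) (subst (All (0ℤ ℤ.≤_)) levels-XE nonneg)
      in (hX≡0 , subst (All (0ℤ ℤ.≤_)) (sym levels-X) (All.∷ʳ⁺ nonnegX ℤᵖ.≤-refl) , subst (All (0ℤ ℤ.<_)) (sym drop-X) [])
       , (trans (sym height-XE) hXE≡0 , nonnegE , subst (All (0ℤ ℤ.<_)) drop-XE zero-free))
    (λ ((_ , nonnegX , _) , (hE≡0 , nonnegE , zero-freeE)) →
      trans height-XE hE≡0 ,
      subst (All (0ℤ ℤ.≤_)) (sym levels-XE)
        (All.++⁺ (proj₁ (All.∷ʳ⁻ (subst (All (0ℤ ℤ.≤_)) levels-X nonnegX))) nonnegE) ,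
      subst (All (0ℤ ℤ.<_)) (sym drop-XE) zero-freeE)
    where
    E-start : 0ℤ ℤ.+ height X ≡ 0ℤ
    E-start = trans (ℤᵖ.+-identityˡ (height X)) hX≡0
    height-XE : height (X ++ E) ≡ height E
    height-XE = trans (height-++ X E) (trans (cong (ℤ._+ height E) hX≡0) (ℤᵖ.+-identityˡ (height E)))
    levels-X : levels 0ℤ X ≡ stepLevels 0ℤ X ∷ʳ 0ℤ
    levels-X = trans (levels≡stepLevels∷ʳend 0ℤ X) (cong (stepLevels 0ℤ X ∷ʳ_) E-start)
    levels-XE : levels 0ℤ (X ++ E) ≡ stepLevels 0ℤ X ++ levels 0ℤ E
    levels-XE = trans (levels-++ 0ℤ X E) (cong (λ z → stepLevels 0ℤ X ++ levels z E) E-start)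
    drop-X : drop (length X) (stepLevels 0ℤ X) ≡ []
    drop-X = drop-all (length X) (stepLevels 0ℤ X) (≤-reflexive (length-stepLevels 0ℤ X))
    drop-XE : drop (length X + c) (stepLevels 0ℤ (X ++ E)) ≡ drop c (stepLevels 0ℤ E)
    drop-XE = trans (sym (drop-drop (length X) c _))
      (cong (drop c) (trans (drop-stepLevels 0ℤ X E) (cong (λ z → stepLevels z E) E-start)))

  ¬ZeroFreeFrom-zero : ∀ X s E → height X ≡ 0ℤ → ¬ ZeroFreeFrom (length X) (X ++ s ∷ E)
  ¬ZeroFreeFrom-zero X s E hX≡0 (_ , _ , zero-free)
    with 0<z ∷ _ ← subst (All (0ℤ ℤ.<_)) (drop-stepLevels 0ℤ X (s ∷ E)) zero-free =
    ℤᵖ.<-irrefl (sym (trans (ℤᵖ.+-identityˡ (height X)) hX≡0)) 0<z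

  module _ (cop : Coprime a b) (0<a : 0 < a) where

    balanced⇒length-divisible : ∀ p → height p ≡ 0ℤ → (a + b) ∣ length p
    balanced⇒length-divisible p h≡0 = subst ((a + b) ∣_) (size-endpoint (0 , 0) p)
      (diagonal-length cop 0<a (proj₁ (endpoint p)) (proj₂ (endpoint p)) (endpoint-diagonal p h≡0))

    -- By coprimality a return to level 0 happens after a multiple of a + b steps, so a return at an
    -- index in [m, m + a + b) with a + b ∣ m happens at m.
    height-zero-at : ∀ X E → (a + b) ∣ length X → a + b ≤ length E →
      ZeroFreeFrom (length X + (a + b)) (X ++ E) → ¬ ZeroFreeFrom (length X) (X ++ E) → height X ≡ 0ℤ
    height-zero-at X E c∣|X| c≤|E| (hXE≡0 , nonneg , zero-free) ¬zero-free =
      trans (sym (trans (ℤᵖ.+-identityʳ z) (ℤᵖ.+-identityˡ (height X))))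
        (subst (λ i → z ℤ.+ height (take i U) ≡ 0ℤ) i≡0 at-zero)
      where
      z = 0ℤ ℤ.+ height X
      U = take (a + b) E
      Y = drop (a + b) E
      |U|≡c : length U ≡ a + b
      |U|≡c = trans (length-take (a + b) E) (m≤n⇒m⊓n≡m c≤|E|)
      stepLevels-E : stepLevels z E ≡ stepLevels z U ++ stepLevels (z ℤ.+ height U) Y
      stepLevels-E = trans (cong (stepLevels z) (sym (take++drop≡id (a + b) E))) (stepLevels-++ z U Y)
      Y-positive : All (0ℤ ℤ.<_) (stepLevels (z ℤ.+ height U) Y)
      Y-positive = subst (All (0ℤ ℤ.<_)) (begin
        drop (length X + (a + b)) (stepLevels 0ℤ (X ++ E))  ≡⟨ drop-drop (length X) (a + b) _ ⟨
        drop (a + b) (drop (length X) (stepLevels 0ℤ (X ++ E)))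
          ≡⟨ cong (drop (a + b)) (trans (drop-stepLevels 0ℤ X E) stepLevels-E) ⟩
        drop (a + b) (stepLevels z U ++ stepLevels (z ℤ.+ height U) Y)
          ≡⟨ cong (λ n → drop n (stepLevels z U ++ stepLevels (z ℤ.+ height U) Y)) (trans (sym |U|≡c) (sym (length-stepLevels z U))) ⟩
        drop (length (stepLevels z U)) (stepLevels z U ++ stepLevels (z ℤ.+ height U) Y)
          ≡⟨ drop-length-++ (stepLevels z U) _ ⟩
        stepLevels (z ℤ.+ height U) Y ∎) zero-free
        where open ≡-Reasoning
      U-not-positive : ¬ All (0ℤ ℤ.<_) (stepLevels z U)
      U-not-positive U-positive = ¬zero-free (hXE≡0 , nonneg ,
        subst (All (0ℤ ℤ.<_)) (sym (trans (drop-stepLevels 0ℤ X E) stepLevels-E)) (All.++⁺ U-positive Y-positive))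
      U-nonneg : All (0ℤ ℤ.≤_) (stepLevels z U)
      U-nonneg = All.++⁻ˡ (stepLevels z U) (subst (All (0ℤ ℤ.≤_)) stepLevels-E
        (proj₁ (All.∷ʳ⁻ (subst (All (0ℤ ℤ.≤_)) (levels≡stepLevels∷ʳend z E)
          (All.++⁻ʳ (stepLevels 0ℤ X) (subst (All (0ℤ ℤ.≤_)) (levels-++ 0ℤ X E) nonneg))))))
      zero-at = zero-prefix z U U-nonneg U-not-positive
      i = proj₁ zero-at
      i<c : i < a + b
      i<c = subst (i <_) |U|≡c (proj₁ (proj₂ zero-at))
      at-zero : z ℤ.+ height (take i U) ≡ 0ℤ
      at-zero = proj₂ (proj₂ zero-at)
      c∣|X|+i : (a + b) ∣ length X + i
      c∣|X|+i = subst ((a + b) ∣_)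
        (trans (length-++ X) (cong (length X +_) (trans (length-take i U) (m≤n⇒m⊓n≡m (<⇒≤ (proj₁ (proj₂ zero-at)))))))
        (balanced⇒length-divisible (X ++ take i U) (trans (height-++ X (take i U))
          (trans (cong (ℤ._+ height (take i U)) (sym (ℤᵖ.+-identityˡ (height X)))) at-zero)))
      i≡0 : i ≡ 0
      i≡0 = ∣∧<⇒≡0 (∣m+n∣m⇒∣n c∣|X|+i c∣|X|) i<c

    last-zero-split : ∀ {m} X E → length X ≡ m → (a + b) ∣ m → a + b ≤ length E →
      (ZeroFreeFrom (m + (a + b)) (X ++ E) × ¬ ZeroFreeFrom m (X ++ E)) ⇔ (ZeroFreeFrom m X × ZeroFreeFrom (a + b) E)
    last-zero-split X [] refl c∣m c≤0 = contradiction (≤-trans (m≤m+n a b) c≤0) (<⇒≱ 0<a)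
    last-zero-split X (s ∷ E) refl c∣m c≤|E| = mk⇔
      (λ (zero-free , ¬zero-free) → to (split (height-zero-at X (s ∷ E) c∣m c≤|E| zero-free ¬zero-free)) zero-free)
      (λ (zero-freeX , zero-freeE) → from (split (proj₁ zero-freeX)) (zero-freeX , zero-freeE) ,
                                     ¬ZeroFreeFrom-zero X s E (proj₁ zero-freeX))
      where
      open Equivalence
      split = ZeroFreeFrom-++ X (s ∷ E) (a + b)

    count-last-zero : ∀ m k {n} → m + k ≡ n → (a + b) ∣ m → a + b ≤ k →
      count n (zeroFreeFrom? (m + (a + b))) ≡
      count n (zeroFreeFrom? m) + count m (zeroFreeFrom? m) * count k (zeroFreeFrom? (a + b))
    count-last-zero m k refl c∣m c≤k = begin
      count (m + k) (zeroFreeFrom? (m + (a + b)))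
        ≡⟨ count-partition (m + k) (zeroFreeFrom? (m + (a + b))) (zeroFreeFrom? m) ⟩
      count (m + k) (zeroFreeFrom? (m + (a + b)) ∩? zeroFreeFrom? m) +
      count (m + k) (zeroFreeFrom? (m + (a + b)) ∩? ∁? (zeroFreeFrom? m))
        ≡⟨ cong₂ _+_ (count-cong {n = m + k} _ (zeroFreeFrom? m)
                        (λ _ → mk⇔ proj₂ (λ zf → ZeroFreeFrom-mono m (a + b) zf , zf)))
                     (count-cong {n = m + k} _ halves? split-at-m) ⟩
      count (m + k) (zeroFreeFrom? m) + count (m + k) halves?
        ≡⟨ cong (count (m + k) (zeroFreeFrom? m) +_) (count-concat m k (zeroFreeFrom? m) (zeroFreeFrom? (a + b))) ⟩
      count (m + k) (zeroFreeFrom? m) + count m (zeroFreeFrom? m) * count k (zeroFreeFrom? (a + b)) ∎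
      where
      open ≡-Reasoning
      LastZeroAt : Path → Set
      LastZeroAt D = ZeroFreeFrom (m + (a + b)) D × ¬ ZeroFreeFrom m D
      Halves : Path → Set
      Halves D = ZeroFreeFrom m (take m D) × ZeroFreeFrom (a + b) (drop m D)
      halves? : Decidable Halves
      halves? D = zeroFreeFrom? m (take m D) ×-dec zeroFreeFrom? (a + b) (drop m D)
      split-at-m : ∀ {D} → length D ≡ m + k → LastZeroAt D ⇔ Halves D
      split-at-m {D} |D| = subst (λ D′ → LastZeroAt D′ ⇔ Halves D) (take++drop≡id m D)
        (last-zero-split (take m D) (drop m D) (length-take-+ D |D|) c∣m
          (subst (a + b ≤_) (sym (length-drop-+ D |D|)) c≤k))

    μ-recurrence : ∀ r i → 0 < r → μ a b i (r + suc i) ≡ μ a b 0 r * μ a b i (suc i) + μ a b (suc i) (r + suc i)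
    μ-recurrence r i 0<r = begin
      μ a b i g
        ≡⟨ μ-as-count 0<c i g 0<g ⟩
      count (g * c) (hasFlaws? (i * c))
        ≡⟨ chung-feller (r * c + c) (i * c) (trans (+-assoc (r * c) c (i * c)) g*c≡) ⟩
      count (g * c) (zeroFreeFrom? (r * c + c))
        ≡⟨ count-last-zero (r * c) (suc i * c) g*c≡ (divides r refl) (m≤m+n c (i * c)) ⟩
      count (g * c) (zeroFreeFrom? (r * c)) + count (r * c) (zeroFreeFrom? (r * c)) * count (suc i * c) (zeroFreeFrom? c)
        ≡⟨ +-comm (count (g * c) (zeroFreeFrom? (r * c))) _ ⟩
      count (r * c) (zeroFreeFrom? (r * c)) * count (suc i * c) (zeroFreeFrom? c) + count (g * c) (zeroFreeFrom? (r * c))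
        ≡⟨ cong₂ _+_ (cong₂ _*_ μ₀[r] μᵢ[i+1]) μᵢ₊₁[g] ⟨
      μ a b 0 r * μ a b i (suc i) + μ a b (suc i) g ∎
      where
      open ≡-Reasoning
      c = a + b
      g = r + suc i
      0<c : 0 < c
      0<c = <-≤-trans 0<a (m≤m+n a b)
      0<g : 0 < g
      0<g = <-≤-trans 0<r (m≤m+n r (suc i))
      g*c≡ : r * c + suc i * c ≡ g * c
      g*c≡ = sym (*-distribʳ-+ c r (suc i))
      μ₀[r] : μ a b 0 r ≡ count (r * c) (zeroFreeFrom? (r * c))
      μ₀[r] = trans (μ-as-count 0<c 0 r 0<r) (chung-feller (r * c) 0 (+-identityʳ (r * c)))
      μᵢ[i+1] : μ a b i (suc i) ≡ count (suc i * c) (zeroFreeFrom? c)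
      μᵢ[i+1] = trans (μ-as-count 0<c i (suc i) (s≤s z≤n)) (chung-feller c (i * c) refl)
      μᵢ₊₁[g] : μ a b (suc i) g ≡ count (g * c) (zeroFreeFrom? (r * c))
      μᵢ₊₁[g] = trans (μ-as-count 0<c (suc i) g 0<g) (chung-feller (r * c) (suc i * c) g*c≡)

corollary1p7 : (a b g : ℕ) → 0 < a → 0 < b → Coprime a b → 0 < g →
    (j : ℕ) → 0 < j → j < g →
    μ a b (j ∸ 1) g ≡ μ a b 0 (g ∸ j) * μ a b (j ∸ 1) j + μ a b j g
corollary1p7 a b g 0<a _ cop _ (suc i) _ j<g =
  subst (λ h → μ a b i h ≡ μ a b 0 (g ∸ suc i) * μ a b i (suc i) + μ a b (suc i) h)
        (m∸n+n≡m (<⇒≤ j<g)) (μ-recurrence a b cop 0<a (g ∸ suc i) i (m<n⇒0<n∸m j<g))
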